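{- Let $S_q(m,k)\in\mathbb{Z}[q]$ be defined by $S_q(0,k)=\delta_{0,k}$ and $S_q(m,k)=S_q(m-1,k-1)+[k]_qS_q(m-1,k)$ for $m\geq1$ (with $S_q(m-1,-1)=0$), and let $B_m(a,q)=\sum_{k=0}^mS_q(m,k)a^k$. Then for every $n\geq0$ the matrix $(B_{i+j}(a,q))_{0\leq i,j\leq n}$ has special Smith normal form $\mathrm{diag}\big(1,a^1q^{\binom12}[1]!_q,a^2q^{\binom22}[2]!_q,\ldots,a^nq^{\binom n2}[n]!_q\big)$ over $\mathbb{Z}[a,q]$.
   Context: $[k]_q=1+q+\cdots+q^{k-1}$, $[k]!_q=[1]_q\cdots[k]_q$. For an $m\times n$ matrix $A$ over a commutative ring $R$, a matrix $D$ is a special Smith normal form (SSNF) of $A$ over $R$ if there exist $P\in \mathrm{SL}(m,R)$, $Q\in\mathrm{SL}(n,R)$ with $PAQ=D$, $D$ is diagonal, and $d_{ii}$ is a multiple in $R$ of $d_{jj}$ whenever $i\geq j$. -}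

module Defs where

open import Data.Nat as ℕ using (ℕ; zero; suc; _≤_)
open import Data.Nat.Combinatorics using (_C_)
open import Data.Integer as ℤ using (ℤ; +_; -[1+_])
open import Data.Fin using (Fin; toℕ; punchIn) renaming (zero to fzero; suc to fsuc)
open import Data.List using (List; []; _∷_; _++_; map; concatMap; foldr)
open import Data.Product using (Σ; _×_; _,_)
open import Data.Bool using (if_then_else_; _∧_)
open import Relation.Nullary using (¬_)
open import Relation.Nullary.Decidable using (⌊_⌋)
open import Relation.Binary.PropositionalEquality using (_≡_; _≢_)

-- A polynomial is a finite formal sum of terms  c · a^i q^j,
-- represented as a list of (i , j , c).

Term : Set
Term = ℕ × ℕ × ℤ

Poly : Set
Poly = List Term

coeff : Poly → ℕ → ℕ → ℤ
coeff [] i j = + 0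
coeff ((i′ , j′ , c) ∷ p) i j =
  (if ⌊ i′ ℕ.≟ i ⌋ ∧ ⌊ j′ ℕ.≟ j ⌋ then c else + 0) ℤ.+ coeff p i j

infix 4 _≈_
_≈_ : Poly → Poly → Set
p ≈ r = ∀ i j → coeff p i j ≡ coeff r i j

0P : Poly
0P = []

mono : ℕ → ℕ → ℤ → Poly
mono i j c = (i , j , c) ∷ []

1P : Poly
1P = mono 0 0 (+ 1)

infixl 6 _+P_
infixl 7 _*P_

_+P_ : Poly → Poly → Poly
p +P r = p ++ r

-P_ : Poly → Poly
-P_ = map (λ { (i , j , c) → (i , j , ℤ.- c) })

_*P_ : Poly → Poly → Poly
p *P r = concatMap (λ { (i , j , c) → map (λ { (i′ , j′ , c′) → (i ℕ.+ i′ , j ℕ.+ j′ , c ℤ.* c′) }) r }) p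

a^ : ℕ → Poly
a^ k = mono k 0 (+ 1)

q^ : ℕ → Poly
q^ k = mono 0 k (+ 1)

qint : ℕ → Poly
qint zero = 0P
qint (suc k) = qint k +P q^ k

qfact : ℕ → Poly
qfact zero = 1P
qfact (suc k) = qfact k *P qint (suc k)

Sq : ℕ → ℕ → Poly
Sq zero zero = 1P
Sq zero (suc k) = 0P
-- S_q(m+1,0) = S_q(m,-1) + [0]_q S_q(m,0) with S_q(m,-1) = 0
Sq (suc m) zero = qint 0 *P Sq m 0
Sq (suc m) (suc k) = Sq m k +P qint (suc k) *P Sq m (suc k)

sumUpTo : ℕ → (ℕ → Poly) → Poly
sumUpTo zero f = f 0
sumUpTo (suc n) f = sumUpTo n f +P f (suc n)

B : ℕ → Poly
B m = sumUpTo m (λ k → Sq m k *P a^ k)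

Mat : ℕ → ℕ → Set
Mat m n = Fin m → Fin n → Poly

sumFin : (n : ℕ) → (Fin n → Poly) → Poly
sumFin zero f = 0P
sumFin (suc n) f = f fzero +P sumFin n (λ i → f (fsuc i))

infixl 7 _⊗_
_⊗_ : {m n p : ℕ} → Mat m n → Mat n p → Mat m p
_⊗_ {n = n} A C i k = sumFin n (λ j → A i j *P C j k)

_≈M_ : {m n : ℕ} → Mat m n → Mat m n → Set
A ≈M C = ∀ i j → A i j ≈ C i j

sign : ℕ → Poly → Poly
sign zero x = x
sign (suc k) x = -P (sign k x)

det : (n : ℕ) → Mat n n → Poly
det zero A = 1P
det (suc n) A =
  sumFin (suc n) (λ j → sign (toℕ j) (A fzero j *P det n (λ r c → A (fsuc r) (punchIn j c))))

IsSL : (n : ℕ) → Mat n n → Set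
IsSL n P = det n P ≈ 1P

_∣P_ : Poly → Poly → Set
y ∣P x = Σ Poly (λ c → x ≈ c *P y)

IsDiagonal : {m n : ℕ} → Mat m n → Set
IsDiagonal D = ∀ i j → toℕ i ≢ toℕ j → D i j ≈ 0P

DiagDivides : {m n : ℕ} → Mat m n → Set
DiagDivides {m} {n} D =
  (i j : Fin m) (i′ j′ : Fin n) → toℕ i ≡ toℕ i′ → toℕ j ≡ toℕ j′ →
  toℕ j ≤ toℕ i → D j j′ ∣P D i i′

IsSSNF : {m n : ℕ} → Mat m n → Mat m n → Set
IsSSNF {m} {n} A D =
  Σ (Mat m m) λ P → Σ (Mat n n) λ Q →
    IsSL m P × IsSL n Q × ((P ⊗ A) ⊗ Q) ≈M D × IsDiagonal D × DiagDivides D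

Bmat : (n : ℕ) → Mat (suc n) (suc n)
Bmat n i j = B (toℕ i ℕ.+ toℕ j)

Dmat : (n : ℕ) → Mat (suc n) (suc n)
Dmat n i j with toℕ i ℕ.≟ toℕ j
... | Relation.Nullary.yes _ = a^ (toℕ i) *P q^ (toℕ i C 2) *P qfact (toℕ i)
... | Relation.Nullary.no _ = 0P

-- B_m(a,q) is the m-th moment of the J-fraction with b_k = [k]_q + a q^k and
-- λ_{k+1} = a q^k [k+1]_q: its matrix L of Motzkin-path weights is the product of
-- the q-Stirling matrix S_q with the path matrix for level weights a q^k alone,
-- whose moments are the a^j. For any J-fraction the Hankel matrix of the moments
-- factors as L · diag(μ) · Lᵀ with μ_k = λ_1 ⋯ λ_k, and the unitriangular L is
-- inverted by the matrix P of coefficients of the associated monic orthogonal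
-- polynomials. So P (B_{i+j}) Pᵀ = diag(μ) with det P = 1, and
-- μ_k = a^k q^(k choose 2) [k]!_q, where μ_j divides μ_i for j ≤ i.

module Submission where

open import Algebra.Bundles using (CommutativeRing)
open import Data.Bool using (Bool; true; false; if_then_else_; _∧_)
open import Data.Integer as ℤ using (ℤ; 0ℤ; 1ℤ)
import Data.Integer.Properties as ℤP
open import Data.Integer.Solver using (module +-*-Solver)
open import Data.List using (List; []; _∷_; _++_; map; concatMap)
import Data.List.Properties
open import Data.Nat as ℕ using (ℕ; zero; suc; _∸_; _≤ᵇ_; _<_; _≤_; z≤n; s≤s; z<s; s<s)
open import Data.Nat.Properties
  using (m<n⇒m<1+n; n<1+n; n≤1+n; ≤-trans; <-≤-trans; m≤m+n; m≤n+m; +-suc; <⇒≤; <-trans; ≤⇒≤′; 1+n≢0; suc-injective)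
import Data.Nat.Properties as ℕ
open import Data.Nat.Combinatorics using (_C_; nC1≡n; nCk+nC[k+1]≡[n+1]C[k+1])
open import Data.Fin using (Fin; toℕ; punchIn) renaming (zero to fzero; suc to fsuc)
open import Data.Fin.Properties using (toℕ<n)
open import Data.Product using (Σ; _,_)
open import Data.Empty using (⊥-elim)
open import Data.Maybe using (Maybe; just; nothing)
open import Function using (_∘_; mk⇔)
open import Level using (0ℓ)
open import Relation.Binary.Structures using (IsEquivalence)
open import Relation.Nullary using (Dec; yes; no)
open import Relation.Nullary.Decidable using (⌊_⌋; isYes≗does; does-⇔)
open import Relation.Binary.PropositionalEquality as ≡ using (_≡_; _≢_)
open import Defs hiding (_≈_)

module FiniteSums {c ℓ} (R : CommutativeRing c ℓ) where

  open CommutativeRing R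
  open import Algebra.Properties.Semiring.Sum semiring
    using (sum; sum-syntax; ∑-distrib-+; ∑-comm; sum-cong-≗; *-distribˡ-sum; *-distribʳ-sum)
  open import Relation.Binary.Reasoning.Setoid setoid

  ∑< : ℕ → (ℕ → Carrier) → Carrier
  ∑< zero    f = 0#
  ∑< (suc N) f = f 0 + ∑< N (f ∘ suc)

  ∑<≡sum : ∀ N (f : ℕ → Carrier) → ∑< N f ≡ sum {N} (f ∘ toℕ)
  ∑<≡sum zero    f = ≡.refl
  ∑<≡sum (suc N) f = ≡.cong (f 0 +_) (∑<≡sum N (f ∘ suc))

  ∑<-cong : ∀ N {f g : ℕ → Carrier} → (∀ k → k < N → f k ≈ g k) → ∑< N f ≈ ∑< N g
  ∑<-cong zero    f≈g = refl
  ∑<-cong (suc N) f≈g = +-cong (f≈g 0 z<s) (∑<-cong N (λ k k<N → f≈g (suc k) (s<s k<N)))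

  ∑<-zero : ∀ N {f : ℕ → Carrier} → (∀ k → k < N → f k ≈ 0#) → ∑< N f ≈ 0#
  ∑<-zero zero    f≈0 = refl
  ∑<-zero (suc N) f≈0 =
    trans (+-cong (f≈0 0 z<s) (∑<-zero N (λ k k<N → f≈0 (suc k) (s<s k<N)))) (+-identityˡ 0#)

  ∑<-distrib-+ : ∀ N (f g : ℕ → Carrier) → ∑< N (λ k → f k + g k) ≈ ∑< N f + ∑< N g
  ∑<-distrib-+ N f g rewrite ∑<≡sum N (λ k → f k + g k) | ∑<≡sum N f | ∑<≡sum N g =
    ∑-distrib-+ {N} (f ∘ toℕ) (g ∘ toℕ)

  *-distribˡ-∑< : ∀ N x (f : ℕ → Carrier) → x * ∑< N f ≈ ∑< N (λ k → x * f k)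
  *-distribˡ-∑< N x f rewrite ∑<≡sum N f | ∑<≡sum N (λ k → x * f k) = *-distribˡ-sum {N} x (f ∘ toℕ)

  *-distribʳ-∑< : ∀ N x (f : ℕ → Carrier) → ∑< N f * x ≈ ∑< N (λ k → f k * x)
  *-distribʳ-∑< N x f rewrite ∑<≡sum N f | ∑<≡sum N (λ k → f k * x) = *-distribʳ-sum {N} x (f ∘ toℕ)

  ∑<-comm : ∀ M N (f : ℕ → ℕ → Carrier) →
            ∑< M (λ i → ∑< N (f i)) ≈ ∑< N (λ j → ∑< M (λ i → f i j))
  ∑<-comm M N f = begin
    ∑< M (λ i → ∑< N (f i))                    ≡⟨ ∑<≡sum M _ ⟩
    ∑[ i < M ] ∑< N (f (toℕ i))                ≡⟨ sum-cong-≗ {n = M} (λ i → ∑<≡sum N (f (toℕ i))) ⟩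
    ∑[ i < M ] ∑[ j < N ] f (toℕ i) (toℕ j)    ≈⟨ ∑-comm {M} {N} (λ i j → f (toℕ i) (toℕ j)) ⟩
    ∑[ j < N ] ∑[ i < M ] f (toℕ i) (toℕ j)    ≡⟨ sum-cong-≗ {n = N} (λ j → ∑<≡sum M (λ i → f i (toℕ j))) ⟨
    ∑[ j < N ] ∑< M (λ i → f i (toℕ j))        ≡⟨ ∑<≡sum N _ ⟨
    ∑< N (λ j → ∑< M (λ i → f i j))            ∎

  ∑<-snoc : ∀ N (f : ℕ → Carrier) → ∑< (suc N) f ≈ ∑< N f + f N
  ∑<-snoc zero    f = +-comm (f 0) 0#
  ∑<-snoc (suc N) f = trans (+-congˡ (∑<-snoc N (f ∘ suc))) (sym (+-assoc (f 0) _ _))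

  ∑<-truncate : ∀ {N M} (f : ℕ → Carrier) → N ≤ M → (∀ k → N ≤ k → f k ≈ 0#) → ∑< M f ≈ ∑< N f
  ∑<-truncate {M = M} f z≤n f≈0 = ∑<-zero M (λ k _ → f≈0 k z≤n)
  ∑<-truncate f (s≤s N≤M) f≈0 =
    +-congˡ (∑<-truncate (f ∘ suc) N≤M (λ k N≤k → f≈0 (suc k) (s≤s N≤k)))

  δ : ℕ → ℕ → Carrier
  δ zero    zero    = 1#
  δ zero    (suc k) = 0#
  δ (suc i) zero    = 0#
  δ (suc i) (suc k) = δ i k

  δ-refl : ∀ i → δ i i ≡ 1#
  δ-refl zero    = ≡.refl
  δ-refl (suc i) = δ-refl i

  δ-≢ : ∀ {i k} → i ≢ k → δ i k ≡ 0#
  δ-≢ {zero}  {zero}  i≢k = ⊥-elim (i≢k ≡.refl)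
  δ-≢ {zero}  {suc k} _   = ≡.refl
  δ-≢ {suc i} {zero}  _   = ≡.refl
  δ-≢ {suc i} {suc k} i≢k = δ-≢ (i≢k ∘ ≡.cong suc)

  ∑<-δ : ∀ N i (f : ℕ → Carrier) → i < N → ∑< N (λ k → δ i k * f k) ≈ f i
  ∑<-δ (suc N) zero f _ = begin
    1# * f 0 + ∑< N (λ k → 0# * f (suc k)) ≈⟨ +-cong (*-identityˡ (f 0)) (∑<-zero N (λ k _ → zeroˡ (f (suc k)))) ⟩
    f 0 + 0#                                 ≈⟨ +-identityʳ (f 0) ⟩
    f 0                                      ∎
  ∑<-δ (suc N) (suc i) f (s≤s i<N) =
    trans (+-cong (zeroˡ (f 0)) (∑<-δ N i (f ∘ suc) i<N)) (+-identityˡ (f (suc i)))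

  δ-transfer : ∀ i k (f : ℕ → Carrier) → f k * δ i k ≈ f i * δ i k
  δ-transfer zero    zero    f = refl
  δ-transfer zero    (suc k) f = trans (zeroʳ (f (suc k))) (sym (zeroʳ (f 0)))
  δ-transfer (suc i) zero    f = trans (zeroʳ (f 0)) (sym (zeroʳ (f (suc i))))
  δ-transfer (suc i) (suc k) f = δ-transfer i k (f ∘ suc)

  shift : (ℕ → Carrier) → ℕ → Carrier
  shift f zero    = 0#
  shift f (suc k) = f k

  shift-δ : ∀ i k → shift (δ i) k ≡ δ (suc i) k
  shift-δ i zero    = ≡.refl
  shift-δ i (suc k) = ≡.refl

  shift-cong : ∀ {f g : ℕ → Carrier} → (∀ k → f k ≈ g k) → ∀ k → shift f k ≈ shift g k
  shift-cong f≈g zero    = refl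
  shift-cong f≈g (suc k) = f≈g k

  y≈0⇒x*y≈0 : ∀ x {y} → y ≈ 0# → x * y ≈ 0#
  y≈0⇒x*y≈0 x y≈0 = trans (*-congˡ y≈0) (zeroʳ x)

  x≈0⇒x*y≈0 : ∀ {x} y → x ≈ 0# → x * y ≈ 0#
  x≈0⇒x*y≈0 y x≈0 = trans (*-congʳ x≈0) (zeroˡ y)

-- l k plays the role of λ_{k+1} in the J-fraction
-- 1 / (1 − b₀ x − λ₁ x² / (1 − b₁ x − λ₂ x² / ⋯)).
module JacobiFraction {c ℓ} (R : CommutativeRing c ℓ) (b l : ℕ → CommutativeRing.Carrier R) where

  open CommutativeRing R
  open FiniteSums R
  open import Algebra.Properties.Ring ring using (//-rightDividesˡ; +-cancelʳ; -0#≈0#)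
  open import Algebra.Solver.Ring.NaturalCoefficients.Default commutativeSemiring
    using (solve; _:=_; _:+_; _:*_)
  open import Relation.Binary.Reasoning.Setoid setoid

  μ : ℕ → Carrier
  μ zero    = 1#
  μ (suc k) = l k * μ k

  μ-divides : ∀ {i j} → j ≤ i → Σ Carrier (λ c → μ i ≈ c * μ j)
  μ-divides j≤i = go (≤⇒≤′ j≤i)
    where
    go : ∀ {i j} → j ℕ.≤′ i → Σ Carrier (λ c → μ i ≈ c * μ j)
    go ℕ.≤′-refl                = 1# , sym (*-identityˡ _)
    go (ℕ.≤′-step {i} j≤′i) with go j≤′i
    ... | c , μi≈cμj = l i * c , trans (*-congˡ μi≈cμj) (sym (*-assoc (l i) c _))

  -- L m k is the total weight of the Motzkin paths of length m from height 0 to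
  -- height k, where a level step at height k weighs b k and a down step from
  -- k + 1 to k weighs l k; the moments of the J-fraction are the L m 0.
  L : ℕ → ℕ → Carrier
  L zero    k = δ 0 k
  L (suc m) k = shift (L m) k + b k * L m k + l k * L m (suc k)

  L-upper : ∀ {m k} → m < k → L m k ≈ 0#
  L-upper {zero}  {suc k} _         = refl
  L-upper {suc m} {suc k} (s≤s m<k) = begin
    L m k + b (suc k) * L m (suc k) + l (suc k) * L m (suc (suc k))
      ≈⟨ +-cong (+-cong (L-upper m<k) (y≈0⇒x*y≈0 _ (L-upper (m<n⇒m<1+n m<k))))
                (y≈0⇒x*y≈0 _ (L-upper (m<n⇒m<1+n (m<n⇒m<1+n m<k)))) ⟩
    0# + 0# + 0#
      ≈⟨ trans (+-identityʳ _) (+-identityʳ 0#) ⟩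
    0# ∎

  gram gramUp gramLevel gramDown : ℕ → ℕ → ℕ → Carrier
  gram      N i j = ∑< N (λ k → L i k * L j k * μ k)
  gramUp    N i j = ∑< N (λ k → shift (L i) k * L j k * μ k)
  gramLevel N i j = ∑< N (λ k → b k * (L i k * L j k * μ k))
  gramDown  N i j = ∑< N (λ k → l k * L i (suc k) * L j k * μ k)

  gram-comm : ∀ N i j → gram N i j ≈ gram N j i
  gram-comm N i j = ∑<-cong N (λ k _ → *-congʳ (*-comm (L i k) (L j k)))

  gramLevel-comm : ∀ N i j → gramLevel N i j ≈ gramLevel N j i
  gramLevel-comm N i j = ∑<-cong N (λ k _ → *-congˡ (*-congʳ (*-comm (L i k) (L j k))))

  -- μ (k + 1) = l k * μ k turns the up steps of L i into the down steps of L j.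
  gramUp≈gramDown : ∀ {N} i j → j < N → gramUp N i j ≈ gramDown N j i
  gramUp≈gramDown {suc M} i j (s≤s j≤M) = begin
    0# * L j 0 * μ 0 + ∑< M (λ k → L i k * L j (suc k) * (l k * μ k))
      ≈⟨ trans (+-congʳ (x≈0⇒x*y≈0 _ (zeroˡ _))) (+-identityˡ _) ⟩
    ∑< M (λ k → L i k * L j (suc k) * (l k * μ k))
      ≈⟨ ∑<-cong M (λ k _ → solve 4 (λ x y u m → x :* y :* (u :* m) := u :* y :* x :* m) refl
                                     (L i k) (L j (suc k)) (l k) (μ k)) ⟩
    ∑< M (λ k → l k * L j (suc k) * L i k * μ k)
      ≈⟨ ∑<-truncate _ (n≤1+n M) (λ k M≤k → x≈0⇒x*y≈0 _ (x≈0⇒x*y≈0 _ (y≈0⇒x*y≈0 _ (L-upper (s≤s (≤-trans j≤M M≤k)))))) ⟨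
    gramDown (suc M) j i ∎

  gram-suc : ∀ N i j → gram N (suc i) j ≈ gramUp N i j + gramLevel N i j + gramDown N i j
  gram-suc N i j = begin
    gram N (suc i) j
      ≈⟨ ∑<-cong N (λ k _ → solve 7 (λ s B u x y z m → (s :+ B :* x :+ u :* y) :* z :* m
                                         := s :* z :* m :+ B :* (x :* z :* m) :+ u :* y :* z :* m) refl
                                     (shift (L i) k) (b k) (l k) (L i k) (L i (suc k)) (L j k) (μ k)) ⟩
    ∑< N (λ k → shift (L i) k * L j k * μ k + b k * (L i k * L j k * μ k) + l k * L i (suc k) * L j k * μ k)
      ≈⟨ trans (∑<-distrib-+ N _ _) (+-congʳ (∑<-distrib-+ N _ _)) ⟩
    gramUp N i j + gramLevel N i j + gramDown N i j ∎

  gram-shift : ∀ {N} i j → i < N → j < N → gram N (suc i) j ≈ gram N i (suc j)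
  gram-shift {N} i j i<N j<N = begin
    gram N (suc i) j                                  ≈⟨ gram-suc N i j ⟩
    gramUp N i j + gramLevel N i j + gramDown N i j   ≈⟨ +-congʳ (+-cong (gramUp≈gramDown i j j<N) (gramLevel-comm N i j)) ⟩
    gramDown N j i + gramLevel N j i + gramDown N i j
      ≈⟨ solve 3 (λ x y z → x :+ y :+ z := z :+ y :+ x) refl (gramDown N j i) (gramLevel N j i) (gramDown N i j) ⟩
    gramDown N i j + gramLevel N j i + gramDown N j i ≈⟨ +-congʳ (+-congʳ (gramUp≈gramDown j i i<N)) ⟨
    gramUp N j i + gramLevel N j i + gramDown N j i   ≈⟨ gram-suc N j i ⟨
    gram N (suc j) i                                  ≈⟨ gram-comm N (suc j) i ⟩
    gram N i (suc j)                                  ∎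

  gram≈moment : ∀ i j {N} → i ℕ.+ j < N → gram N i j ≈ L (i ℕ.+ j) 0
  gram≈moment zero j {N} j<N = begin
    ∑< N (λ k → δ 0 k * L j k * μ k)   ≈⟨ ∑<-cong N (λ k _ → *-assoc (δ 0 k) (L j k) (μ k)) ⟩
    ∑< N (λ k → δ 0 k * (L j k * μ k)) ≈⟨ ∑<-δ N 0 (λ k → L j k * μ k) (≤-trans (s≤s z≤n) j<N) ⟩
    L j 0 * 1#                         ≈⟨ *-identityʳ (L j 0) ⟩
    L j 0                              ∎
  gram≈moment (suc i) j {N} lt = begin
    gram N (suc i) j     ≈⟨ gram-shift i j (≤-trans (m≤m+n (suc i) j) (<⇒≤ lt)) (≤-trans (s≤s (m≤n+m j (suc i))) lt) ⟩
    gram N i (suc j)     ≈⟨ gram≈moment i (suc j) (≡.subst (_< N) (≡.sym (+-suc i j)) lt) ⟩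
    L (i ℕ.+ suc j) 0    ≡⟨ ≡.cong (λ n → L n 0) (+-suc i j) ⟩
    L (suc i ℕ.+ j) 0    ∎

  gram-truncate : ∀ {N K} i j → i < N → N ≤ K → gram K i j ≈ gram N i j
  gram-truncate i j i<N N≤K =
    ∑<-truncate _ N≤K (λ k N≤k → x≈0⇒x*y≈0 _ (x≈0⇒x*y≈0 _ (L-upper (<-≤-trans i<N N≤k))))

  moment≈gram : ∀ {N} i j → i < N → L (i ℕ.+ j) 0 ≈ gram N i j
  moment≈gram {N} i j i<N = begin
    L (i ℕ.+ j) 0  ≈⟨ gram≈moment i j (n<1+n (i ℕ.+ j)) ⟨
    gram K i j     ≈⟨ gram-truncate i j (s≤s (m≤m+n i j)) (m≤n+m K N) ⟨
    gram (N ℕ.+ K) i j ≈⟨ gram-truncate i j i<N (m≤m+n N K) ⟩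
    gram N i j     ∎
    where K = suc (i ℕ.+ j)

  -- Row i of P holds the coefficients of the i-th monic orthogonal polynomial,
  -- p_{i+1} = (x − b i) p_i − λ_i p_{i−1}; P₋ i is the last term and shift is
  -- multiplication by x.
  mutual
    P : ℕ → ℕ → Carrier
    P zero    j = δ 0 j
    P (suc i) j = shift (P i) j - (b i * P i j + P₋ i j)

    P₋ : ℕ → ℕ → Carrier
    P₋ zero    j = 0#
    P₋ (suc i) j = l i * P i j

  x-0≈x : ∀ x → x - 0# ≈ x
  x-0≈x x = trans (+-congˡ -0#≈0#) (+-identityʳ x)

  mutual
    P-upper : ∀ {i j} → i < j → P i j ≈ 0#
    P-upper {zero}  {suc j} _         = refl
    P-upper {suc i} {suc j} (s≤s i<j) = begin
      P i j - (b i * P i (suc j) + P₋ i (suc j))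
        ≈⟨ +-cong (P-upper i<j) (-‿cong (+-cong (y≈0⇒x*y≈0 (b i) (P-upper i<1+j)) (P₋-upper (<⇒≤ i<1+j)))) ⟩
      0# - (0# + 0#)
        ≈⟨ trans (+-congˡ (-‿cong (+-identityˡ 0#))) (x-0≈x 0#) ⟩
      0# ∎
      where i<1+j = m<n⇒m<1+n i<j

    P₋-upper : ∀ {i j} → i ≤ j → P₋ i j ≈ 0#
    P₋-upper {zero}  _   = refl
    P₋-upper {suc i} i<j = y≈0⇒x*y≈0 (l i) (P-upper i<j)

  P-diag : ∀ i → P i i ≈ 1#
  P-diag zero    = refl
  P-diag (suc i) = begin
    P i i - (b i * P i (suc i) + P₋ i (suc i))
      ≈⟨ +-cong (P-diag i) (-‿cong (+-cong (y≈0⇒x*y≈0 (b i) (P-upper (n<1+n i))) (P₋-upper (n≤1+n i)))) ⟩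
    1# - (0# + 0#)
      ≈⟨ trans (+-congˡ (-‿cong (+-identityˡ 0#))) (x-0≈x 1#) ⟩
    1# ∎

  P-step : ∀ i j → P (suc i) j + (b i * P i j + P₋ i j) ≈ shift (P i) j
  P-step i j = //-rightDividesˡ (b i * P i j + P₋ i j) (shift (P i) j)

  rowL : ℕ → (ℕ → Carrier) → ℕ → Carrier
  rowL N r k = ∑< N (λ j → r j * L j k)

  shift-rowL : ∀ N r k → shift (rowL N r) k ≈ ∑< N (λ j → r j * shift (L j) k)
  shift-rowL N r zero    = sym (∑<-zero N (λ j _ → zeroʳ (r j)))
  shift-rowL N r (suc k) = refl

  -- Multiplying a row by x corresponds to one more step of the paths.
  rowL-shift : ∀ M r k → (∀ j → M ≤ j → r j ≈ 0#) →
               rowL (suc M) (shift r) k ≈ shift (rowL (suc M) r) k + b k * rowL (suc M) r k + l k * rowL (suc M) r (suc k)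
  rowL-shift M r k r≈0 = begin
    0# * L 0 k + ∑< M (λ j → r j * L (suc j) k)
      ≈⟨ trans (+-congʳ (zeroˡ (L 0 k))) (+-identityˡ _) ⟩
    ∑< M (λ j → r j * L (suc j) k)
      ≈⟨ ∑<-truncate (λ j → r j * L (suc j) k) (n≤1+n M) (λ j M≤j → x≈0⇒x*y≈0 _ (r≈0 j M≤j)) ⟨
    ∑< N (λ j → r j * L (suc j) k)
      ≈⟨ ∑<-cong N (λ j _ → solve 6 (λ x s B y u z → x :* (s :+ B :* y :+ u :* z) := x :* s :+ B :* (x :* y) :+ u :* (x :* z)) refl
                                    (r j) (shift (L j) k) (b k) (L j k) (l k) (L j (suc k))) ⟩
    ∑< N (λ j → up j + level j + down j)
      ≈⟨ trans (∑<-distrib-+ N (λ j → up j + level j) down) (+-congʳ (∑<-distrib-+ N up level)) ⟩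
    ∑< N up + ∑< N level + ∑< N down
      ≈⟨ +-cong (+-cong (shift-rowL N r k) (*-distribˡ-∑< N (b k) (λ j → r j * L j k)))
                (*-distribˡ-∑< N (l k) (λ j → r j * L j (suc k))) ⟨
    shift (rowL N r) k + b k * rowL N r k + l k * rowL N r (suc k) ∎
    where
    N = suc M
    up level down : ℕ → Carrier
    up    j = r j * shift (L j) k
    level j = b k * (r j * L j k)
    down  j = l k * (r j * L j (suc k))

  rowL-step : ∀ N i k → rowL N (P (suc i)) k + (b i * rowL N (P i) k + rowL N (P₋ i) k) ≈ rowL N (shift (P i)) k
  rowL-step N i k = begin
    rowL N (P (suc i)) k + (b i * rowL N (P i) k + rowL N (P₋ i) k)
      ≈⟨ +-congˡ (+-congʳ (*-distribˡ-∑< N (b i) _)) ⟩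
    rowL N (P (suc i)) k + (∑< N (λ j → b i * (P i j * L j k)) + rowL N (P₋ i) k)
      ≈⟨ trans (∑<-distrib-+ N _ _) (+-congˡ (∑<-distrib-+ N _ _)) ⟨
    ∑< N (λ j → P (suc i) j * L j k + (b i * (P i j * L j k) + P₋ i j * L j k))
      ≈⟨ ∑<-cong N (λ j _ → trans (solve 5 (λ p B q r m → p :* m :+ (B :* (q :* m) :+ r :* m) := (p :+ (B :* q :+ r)) :* m) refl
                                             (P (suc i) j) (b i) (P i j) (P₋ i j) (L j k))
                                      (*-congʳ (P-step i j))) ⟩
    rowL N (shift (P i)) k ∎

  mutual
    P-inverse : ∀ {N} i → i < N → ∀ k → rowL N (P i) k ≈ δ i k
    P-inverse {N}     zero    0<N       k = ∑<-δ N 0 (λ j → L j k) 0<N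
    P-inverse {suc M} (suc i) (s≤s i<M) k = +-cancelʳ Y (rowL N (P (suc i)) k) (δ (suc i) k) (begin
      rowL N (P (suc i)) k + Y
        ≈⟨ +-congˡ (+-cong (*-congˡ (IH k)) (rowL-P₋ i i<N k)) ⟨
      rowL N (P (suc i)) k + (b i * rowL N (P i) k + rowL N (P₋ i) k)
        ≈⟨ rowL-step N i k ⟩
      rowL N (shift (P i)) k
        ≈⟨ rowL-shift M (P i) k (λ j M≤j → P-upper (<-≤-trans i<M M≤j)) ⟩
      shift (rowL N (P i)) k + b k * rowL N (P i) k + l k * rowL N (P i) (suc k)
        ≈⟨ +-cong (+-cong (shift-cong IH k) (*-congˡ (IH k))) (*-congˡ (IH (suc k))) ⟩
      shift (δ i) k + b k * δ i k + l k * δ i (suc k)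
        ≈⟨ trans (+-congʳ (+-congˡ (δ-transfer i k b))) (+-assoc _ _ _) ⟩
      shift (δ i) k + Y
        ≡⟨ ≡.cong (_+ Y) (shift-δ i k) ⟩
      δ (suc i) k + Y ∎)
      where
      N = suc M
      Y = b i * δ i k + l k * δ i (suc k)
      i<N = m<n⇒m<1+n i<M
      IH = P-inverse i i<N

    rowL-P₋ : ∀ {N} i → i < N → ∀ k → rowL N (P₋ i) k ≈ l k * δ i (suc k)
    rowL-P₋ {N} zero    _   k = trans (∑<-zero N (λ j _ → zeroˡ (L j k))) (sym (zeroʳ (l k)))
    rowL-P₋ {N} (suc h) h<N k = begin
      ∑< N (λ j → l h * P h j * L j k)   ≈⟨ ∑<-cong N (λ j _ → *-assoc (l h) (P h j) (L j k)) ⟩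
      ∑< N (λ j → l h * (P h j * L j k)) ≈⟨ *-distribˡ-∑< N (l h) (λ j → P h j * L j k) ⟨
      l h * rowL N (P h) k              ≈⟨ *-congˡ (P-inverse h (<-trans (n<1+n h) h<N) k) ⟩
      l h * δ h k                       ≈⟨ δ-transfer h k l ⟨
      l k * δ h k                       ∎

  hankel-diagonalisation : ∀ N i k → i < N → k < N →
    ∑< N (λ j′ → ∑< N (λ j → P i j * L (j ℕ.+ j′) 0) * P k j′) ≈ μ i * δ k i
  hankel-diagonalisation N i k i<N k<N = begin
    ∑< N (λ j′ → ∑< N (λ j → P i j * L (j ℕ.+ j′) 0) * P k j′)
      ≈⟨ ∑<-cong N (λ j′ _ → trans (*-congʳ (row j′)) (solve 3 (λ x m p → x :* m :* p := m :* (p :* x)) refl (L j′ i) (μ i) (P k j′))) ⟩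
    ∑< N (λ j′ → μ i * (P k j′ * L j′ i)) ≈⟨ *-distribˡ-∑< N (μ i) (λ j′ → P k j′ * L j′ i) ⟨
    μ i * rowL N (P k) i                  ≈⟨ *-congˡ (P-inverse k k<N i) ⟩
    μ i * δ k i                           ∎
    where
    row : ∀ j′ → ∑< N (λ j → P i j * L (j ℕ.+ j′) 0) ≈ L j′ i * μ i
    row j′ = begin
      ∑< N (λ j → P i j * L (j ℕ.+ j′) 0)
        ≈⟨ ∑<-cong N (λ j j<N → *-congˡ (moment≈gram j j′ j<N)) ⟩
      ∑< N (λ j → P i j * gram N j j′)
        ≈⟨ ∑<-cong N (λ j _ → *-distribˡ-∑< N (P i j) (λ r → L j r * L j′ r * μ r)) ⟩
      ∑< N (λ j → ∑< N (λ r → P i j * (L j r * L j′ r * μ r)))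
        ≈⟨ ∑<-comm N N (λ j r → P i j * (L j r * L j′ r * μ r)) ⟩
      ∑< N (λ r → ∑< N (λ j → P i j * (L j r * L j′ r * μ r)))
        ≈⟨ ∑<-cong N (λ r _ → trans (∑<-cong N (λ j _ → solve 4 (λ p x y m → p :* (x :* y :* m) := p :* x :* (y :* m)) refl
                                                                 (P i j) (L j r) (L j′ r) (μ r)))
                                        (sym (*-distribʳ-∑< N (L j′ r * μ r) (λ j → P i j * L j r)))) ⟩
      ∑< N (λ r → rowL N (P i) r * (L j′ r * μ r))
        ≈⟨ ∑<-cong N (λ r _ → *-congʳ (P-inverse i i<N r)) ⟩
      ∑< N (λ r → δ i r * (L j′ r * μ r)) ≈⟨ ∑<-δ N i (λ r → L j′ r * μ r) i<N ⟩
      L j′ i * μ i ∎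

module PolynomialRing where

  open Defs using (_≈_)
  open ≡ using (refl; sym; trans; cong; cong₂)
  open ≡.≡-Reasoning
  open +-*-Solver using (solve; _:=_; _:+_; _:*_)

  ∑ₗ : {A : Set} → List A → (A → ℤ) → ℤ
  ∑ₗ []       f = 0ℤ
  ∑ₗ (x ∷ xs) f = f x ℤ.+ ∑ₗ xs f

  module _ {A : Set} where

    ∑ₗ-++ : ∀ (xs ys : List A) f → ∑ₗ (xs ++ ys) f ≡ ∑ₗ xs f ℤ.+ ∑ₗ ys f
    ∑ₗ-++ []       ys f = sym (ℤP.+-identityˡ _)
    ∑ₗ-++ (x ∷ xs) ys f = trans (cong (ℤ._+_ (f x)) (∑ₗ-++ xs ys f)) (sym (ℤP.+-assoc (f x) _ _))

    ∑ₗ-cong : ∀ (xs : List A) {f g} → (∀ x → f x ≡ g x) → ∑ₗ xs f ≡ ∑ₗ xs g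
    ∑ₗ-cong []       f≡g = refl
    ∑ₗ-cong (x ∷ xs) f≡g = cong₂ ℤ._+_ (f≡g x) (∑ₗ-cong xs f≡g)

    ∑ₗ-zero : ∀ (xs : List A) → ∑ₗ xs (λ _ → 0ℤ) ≡ 0ℤ
    ∑ₗ-zero []       = refl
    ∑ₗ-zero (x ∷ xs) = trans (ℤP.+-identityˡ _) (∑ₗ-zero xs)

    ∑ₗ-+ : ∀ (xs : List A) f g → ∑ₗ xs (λ x → f x ℤ.+ g x) ≡ ∑ₗ xs f ℤ.+ ∑ₗ xs g
    ∑ₗ-+ []       f g = refl
    ∑ₗ-+ (x ∷ xs) f g = trans (cong (ℤ._+_ (f x ℤ.+ g x)) (∑ₗ-+ xs f g))
      (solve 4 (λ a b c d → (a :+ b) :+ (c :+ d) := (a :+ c) :+ (b :+ d)) refl (f x) (g x) (∑ₗ xs f) (∑ₗ xs g))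

    ∑ₗ-*ʳ : ∀ (xs : List A) f c → ∑ₗ xs (λ x → f x ℤ.* c) ≡ ∑ₗ xs f ℤ.* c
    ∑ₗ-*ʳ []       f c = sym (ℤP.*-zeroˡ c)
    ∑ₗ-*ʳ (x ∷ xs) f c = trans (cong (ℤ._+_ (f x ℤ.* c)) (∑ₗ-*ʳ xs f c)) (sym (ℤP.*-distribʳ-+ c (f x) _))

  ∑ₗ-map : ∀ {A B : Set} (g : A → B) (xs : List A) f → ∑ₗ (map g xs) f ≡ ∑ₗ xs (f ∘ g)
  ∑ₗ-map g []       f = refl
  ∑ₗ-map g (x ∷ xs) f = cong (ℤ._+_ (f (g x))) (∑ₗ-map g xs f)

  ∑ₗ-concatMap : ∀ {A B : Set} (g : A → List B) (xs : List A) f →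
                 ∑ₗ (concatMap g xs) f ≡ ∑ₗ xs (λ x → ∑ₗ (g x) f)
  ∑ₗ-concatMap g []       f = refl
  ∑ₗ-concatMap g (x ∷ xs) f = trans (∑ₗ-++ (g x) (concatMap g xs) f) (cong (ℤ._+_ (∑ₗ (g x) f)) (∑ₗ-concatMap g xs f))

  ∑ₗ-comm : ∀ {A B : Set} (xs : List A) (ys : List B) (f : A → B → ℤ) →
            ∑ₗ xs (λ x → ∑ₗ ys (f x)) ≡ ∑ₗ ys (λ y → ∑ₗ xs (λ x → f x y))
  ∑ₗ-comm []       ys f = sym (∑ₗ-zero ys)
  ∑ₗ-comm (x ∷ xs) ys f =
    trans (cong (ℤ._+_ (∑ₗ ys (f x))) (∑ₗ-comm xs ys f)) (sym (∑ₗ-+ ys (f x) (λ y → ∑ₗ xs (λ x → f x y))))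

  termCoeff : Term → ℕ → ℕ → ℤ
  termCoeff (i′ , j′ , c) i j = if ⌊ i′ ℕ.≟ i ⌋ ∧ ⌊ j′ ℕ.≟ j ⌋ then c else 0ℤ

  coeff≡∑ₗ : ∀ p i j → coeff p i j ≡ ∑ₗ p (λ t → termCoeff t i j)
  coeff≡∑ₗ []      i j = refl
  coeff≡∑ₗ (t ∷ p) i j = cong (ℤ._+_ (termCoeff t i j)) (coeff≡∑ₗ p i j)

  coeff-+P : ∀ p r i j → coeff (p +P r) i j ≡ coeff p i j ℤ.+ coeff r i j
  coeff-+P p r i j = begin
    coeff (p ++ r) i j                                              ≡⟨ coeff≡∑ₗ (p ++ r) i j ⟩
    ∑ₗ (p ++ r) (λ t → termCoeff t i j)                             ≡⟨ ∑ₗ-++ p r _ ⟩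
    ∑ₗ p (λ t → termCoeff t i j) ℤ.+ ∑ₗ r (λ t → termCoeff t i j) ≡⟨ cong₂ ℤ._+_ (coeff≡∑ₗ p i j) (coeff≡∑ₗ r i j) ⟨
    coeff p i j ℤ.+ coeff r i j                                     ∎

  if-neg : ∀ (b : Bool) (c : ℤ) → (if b then ℤ.- c else 0ℤ) ≡ ℤ.- (if b then c else 0ℤ)
  if-neg true  c = refl
  if-neg false c = refl

  coeff--P : ∀ p i j → coeff (-P p) i j ≡ ℤ.- coeff p i j
  coeff--P []                  i j = refl
  coeff--P ((i′ , j′ , c) ∷ p) i j =
    trans (cong₂ ℤ._+_ (if-neg (⌊ i′ ℕ.≟ i ⌋ ∧ ⌊ j′ ℕ.≟ j ⌋) c) (coeff--P p i j))
          (sym (ℤP.neg-distrib-+ (termCoeff (i′ , j′ , c) i j) (coeff p i j)))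

  infixl 7 _·ₜ_
  _·ₜ_ : Term → Term → Term
  (i , j , c) ·ₜ (i′ , j′ , c′) = (i ℕ.+ i′ , j ℕ.+ j′ , c ℤ.* c′)

  coeff-*P : ∀ p r i j → coeff (p *P r) i j ≡ ∑ₗ p (λ t → ∑ₗ r (λ u → termCoeff (t ·ₜ u) i j))
  coeff-*P p r i j = begin
    coeff (p *P r) i j                   ≡⟨ coeff≡∑ₗ (p *P r) i j ⟩
    ∑ₗ (p *P r) (λ t → termCoeff t i j)                 ≡⟨ ∑ₗ-concatMap _ p _ ⟩
    ∑ₗ p (λ t → ∑ₗ (map (t ·ₜ_) r) (λ v → termCoeff v i j)) ≡⟨ ∑ₗ-cong p (λ t → ∑ₗ-map (t ·ₜ_) r (λ v → termCoeff v i j)) ⟩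
    ∑ₗ p (λ t → ∑ₗ r (λ u → termCoeff (t ·ₜ u) i j))     ∎

  ⌊⌋-⇔ : ∀ {A B : Set} → (A → B) → (B → A) → (a? : Dec A) (b? : Dec B) → ⌊ a? ⌋ ≡ ⌊ b? ⌋
  ⌊⌋-⇔ f g a? b? = trans (isYes≗does a?) (trans (does-⇔ (mk⇔ f g) a? b?) (sym (isYes≗does b?)))

  ≟-+-split : ∀ a b i → ⌊ a ℕ.+ b ℕ.≟ i ⌋ ≡ (b ≤ᵇ i) ∧ ⌊ a ℕ.≟ i ∸ b ⌋
  ≟-+-split a zero i =
    ⌊⌋-⇔ (trans (sym (ℕ.+-identityʳ a))) (trans (ℕ.+-identityʳ a)) (a ℕ.+ 0 ℕ.≟ i) (a ℕ.≟ i)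
  ≟-+-split a (suc b) zero =
    ⌊⌋-⇔ (λ a+1+b≡0 → ⊥-elim (1+n≢0 (trans (sym (+-suc a b)) a+1+b≡0))) (λ ()) (a ℕ.+ suc b ℕ.≟ 0) (1 ℕ.≟ 0)
  ≟-+-split a (suc b) (suc i) = begin
    ⌊ a ℕ.+ suc b ℕ.≟ suc i ⌋ ≡⟨ ⌊⌋-⇔ (λ e → suc-injective (trans (sym (+-suc a b)) e)) (λ e → trans (+-suc a b) (cong suc e))
                                      (a ℕ.+ suc b ℕ.≟ suc i) (a ℕ.+ b ℕ.≟ i) ⟩
    ⌊ a ℕ.+ b ℕ.≟ i ⌋         ≡⟨ ≟-+-split a b i ⟩
    (b ≤ᵇ i) ∧ ⌊ a ℕ.≟ i ∸ b ⌋ ≡⟨ cong (_∧ ⌊ a ℕ.≟ i ∸ b ⌋) (≤ᵇ-suc b i) ⟩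
    (suc b ≤ᵇ suc i) ∧ ⌊ a ℕ.≟ i ∸ b ⌋ ∎
    where
    ≤ᵇ-suc : ∀ b i → (b ≤ᵇ i) ≡ (suc b ≤ᵇ suc i)
    ≤ᵇ-suc zero    i = refl
    ≤ᵇ-suc (suc b) i = refl

  shiftedCoeff : (ℕ → ℕ → ℤ) → Term → ℕ → ℕ → ℤ
  shiftedCoeff F (i′ , j′ , c) i j = if (i′ ≤ᵇ i) ∧ (j′ ≤ᵇ j) then F (i ∸ i′) (j ∸ j′) ℤ.* c else 0ℤ

  if-∧-* : ∀ a x b y (c c′ : ℤ) → (if (a ∧ x) ∧ (b ∧ y) then c ℤ.* c′ else 0ℤ)
                                ≡ (if a ∧ b then (if x ∧ y then c else 0ℤ) ℤ.* c′ else 0ℤ)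
  if-∧-* false x     b     y     c c′ = refl
  if-∧-* true  true  false y     c c′ = refl
  if-∧-* true  false false y     c c′ = refl
  if-∧-* true  true  true  true  c c′ = refl
  if-∧-* true  true  true  false c c′ = refl
  if-∧-* true  false true  y     c c′ = refl

  termCoeff-·ₜ : ∀ t u i j → termCoeff (t ·ₜ u) i j ≡ shiftedCoeff (termCoeff t) u i j
  termCoeff-·ₜ (i₁ , j₁ , c₁) (i₂ , j₂ , c₂) i j
    rewrite ≟-+-split i₁ i₂ i | ≟-+-split j₁ j₂ j = if-∧-* (i₂ ≤ᵇ i) _ (j₂ ≤ᵇ j) _ c₁ c₂

  ∑ₗ-shiftedCoeff : ∀ p u i j → ∑ₗ p (λ t → shiftedCoeff (termCoeff t) u i j) ≡ shiftedCoeff (coeff p) u i j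
  ∑ₗ-shiftedCoeff p (i′ , j′ , c) i j with (i′ ≤ᵇ i) ∧ (j′ ≤ᵇ j)
  ... | true  = trans (∑ₗ-*ʳ p _ c) (cong (ℤ._* c) (sym (coeff≡∑ₗ p (i ∸ i′) (j ∸ j′))))
  ... | false = ∑ₗ-zero p

  coeff-*P-shifted : ∀ p r i j → coeff (p *P r) i j ≡ ∑ₗ r (λ u → shiftedCoeff (coeff p) u i j)
  coeff-*P-shifted p r i j = begin
    coeff (p *P r) i j                                      ≡⟨ coeff-*P p r i j ⟩
    ∑ₗ p (λ t → ∑ₗ r (λ u → termCoeff (t ·ₜ u) i j))        ≡⟨ ∑ₗ-comm p r _ ⟩
    ∑ₗ r (λ u → ∑ₗ p (λ t → termCoeff (t ·ₜ u) i j))        ≡⟨ ∑ₗ-cong r (λ u → ∑ₗ-cong p (λ t → termCoeff-·ₜ t u i j)) ⟩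
    ∑ₗ r (λ u → ∑ₗ p (λ t → shiftedCoeff (termCoeff t) u i j)) ≡⟨ ∑ₗ-cong r (λ u → ∑ₗ-shiftedCoeff p u i j) ⟩
    ∑ₗ r (λ u → shiftedCoeff (coeff p) u i j)               ∎

  shiftedCoeff-cong : ∀ {F G : ℕ → ℕ → ℤ} → (∀ i j → F i j ≡ G i j) → ∀ u i j → shiftedCoeff F u i j ≡ shiftedCoeff G u i j
  shiftedCoeff-cong F≡G (i′ , j′ , c) i j = cong (λ z → if (i′ ≤ᵇ i) ∧ (j′ ≤ᵇ j) then z ℤ.* c else 0ℤ) (F≡G _ _)

  ·ₜ-comm : ∀ t u → t ·ₜ u ≡ u ·ₜ t
  ·ₜ-comm (i , j , c) (i′ , j′ , c′) rewrite ℕ.+-comm i i′ | ℕ.+-comm j j′ | ℤP.*-comm c c′ = refl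

  ·ₜ-assoc : ∀ t u w → (t ·ₜ u) ·ₜ w ≡ t ·ₜ (u ·ₜ w)
  ·ₜ-assoc (i , j , c) (i′ , j′ , c′) (i″ , j″ , c″)
    rewrite ℕ.+-assoc i i′ i″ | ℕ.+-assoc j j′ j″ | ℤP.*-assoc c c′ c″ = refl

  *P-comm : ∀ p r → p *P r ≈ r *P p
  *P-comm p r i j = begin
    coeff (p *P r) i j                                 ≡⟨ coeff-*P p r i j ⟩
    ∑ₗ p (λ t → ∑ₗ r (λ u → termCoeff (t ·ₜ u) i j))   ≡⟨ ∑ₗ-comm p r _ ⟩
    ∑ₗ r (λ u → ∑ₗ p (λ t → termCoeff (t ·ₜ u) i j))   ≡⟨ ∑ₗ-cong r (λ u → ∑ₗ-cong p (λ t → cong (λ v → termCoeff v i j) (·ₜ-comm t u))) ⟩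
    ∑ₗ r (λ u → ∑ₗ p (λ t → termCoeff (u ·ₜ t) i j))   ≡⟨ coeff-*P r p i j ⟨
    coeff (r *P p) i j                                 ∎

  *P-congˡ : ∀ {p p′} r → p ≈ p′ → p *P r ≈ p′ *P r
  *P-congˡ {p} {p′} r p≈p′ i j = begin
    coeff (p *P r) i j                           ≡⟨ coeff-*P-shifted p r i j ⟩
    ∑ₗ r (λ u → shiftedCoeff (coeff p) u i j)    ≡⟨ ∑ₗ-cong r (λ u → shiftedCoeff-cong p≈p′ u i j) ⟩
    ∑ₗ r (λ u → shiftedCoeff (coeff p′) u i j)   ≡⟨ coeff-*P-shifted p′ r i j ⟨
    coeff (p′ *P r) i j                          ∎

  *P-cong : ∀ {p p′ r r′} → p ≈ p′ → r ≈ r′ → p *P r ≈ p′ *P r′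
  *P-cong {p} {p′} {r} {r′} p≈p′ r≈r′ i j = begin
    coeff (p *P r) i j   ≡⟨ *P-congˡ {p} {p′} r p≈p′ i j ⟩
    coeff (p′ *P r) i j  ≡⟨ *P-comm p′ r i j ⟩
    coeff (r *P p′) i j  ≡⟨ *P-congˡ {r} {r′} p′ r≈r′ i j ⟩
    coeff (r′ *P p′) i j ≡⟨ *P-comm r′ p′ i j ⟩
    coeff (p′ *P r′) i j ∎

  *P-assoc : ∀ p r s → (p *P r) *P s ≈ p *P (r *P s)
  *P-assoc p r s i j = begin
    coeff ((p *P r) *P s) i j                                        ≡⟨ coeff-*P (p *P r) s i j ⟩
    ∑ₗ (p *P r) (λ v → ∑ₗ s (λ w → termCoeff (v ·ₜ w) i j))           ≡⟨ ∑ₗ-concatMap _ p _ ⟩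
    ∑ₗ p (λ t → ∑ₗ (map (t ·ₜ_) r) (λ v → ∑ₗ s (λ w → termCoeff (v ·ₜ w) i j)))
                                                                     ≡⟨ ∑ₗ-cong p (λ t → ∑ₗ-map (t ·ₜ_) r _) ⟩
    ∑ₗ p (λ t → ∑ₗ r (λ u → ∑ₗ s (λ w → termCoeff ((t ·ₜ u) ·ₜ w) i j)))
      ≡⟨ ∑ₗ-cong p (λ t → ∑ₗ-cong r (λ u → ∑ₗ-cong s (λ w → cong (λ v → termCoeff v i j) (·ₜ-assoc t u w)))) ⟩
    ∑ₗ p (λ t → ∑ₗ r (λ u → ∑ₗ s (λ w → termCoeff (t ·ₜ (u ·ₜ w)) i j)))
      ≡⟨ ∑ₗ-cong p (λ t → trans (∑ₗ-concatMap _ r _) (∑ₗ-cong r (λ u → ∑ₗ-map (u ·ₜ_) s _))) ⟨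
    ∑ₗ p (λ t → ∑ₗ (r *P s) (λ v → termCoeff (t ·ₜ v) i j))           ≡⟨ coeff-*P p (r *P s) i j ⟨
    coeff (p *P (r *P s)) i j                                        ∎

  *P-distribʳ : ∀ p r s → (r +P s) *P p ≈ r *P p +P s *P p
  *P-distribʳ p r s i j = begin
    coeff ((r +P s) *P p) i j                                   ≡⟨ coeff-*P (r +P s) p i j ⟩
    ∑ₗ (r ++ s) (λ t → ∑ₗ p (λ u → termCoeff (t ·ₜ u) i j))     ≡⟨ ∑ₗ-++ r s _ ⟩
    ∑ₗ r (λ t → ∑ₗ p (λ u → termCoeff (t ·ₜ u) i j)) ℤ.+ ∑ₗ s (λ t → ∑ₗ p (λ u → termCoeff (t ·ₜ u) i j))
                                                                ≡⟨ cong₂ ℤ._+_ (coeff-*P r p i j) (coeff-*P s p i j) ⟨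
    coeff (r *P p) i j ℤ.+ coeff (s *P p) i j                   ≡⟨ coeff-+P (r *P p) (s *P p) i j ⟨
    coeff (r *P p +P s *P p) i j                                ∎

  *P-distribˡ : ∀ p r s → p *P (r +P s) ≈ p *P r +P p *P s
  *P-distribˡ p r s i j = begin
    coeff (p *P (r +P s)) i j      ≡⟨ *P-comm p (r +P s) i j ⟩
    coeff ((r +P s) *P p) i j      ≡⟨ *P-distribʳ p r s i j ⟩
    coeff (r *P p +P s *P p) i j   ≡⟨ coeff-+P (r *P p) (s *P p) i j ⟩
    coeff (r *P p) i j ℤ.+ coeff (s *P p) i j ≡⟨ cong₂ ℤ._+_ (*P-comm r p i j) (*P-comm s p i j) ⟩
    coeff (p *P r) i j ℤ.+ coeff (p *P s) i j ≡⟨ coeff-+P (p *P r) (p *P s) i j ⟨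
    coeff (p *P r +P p *P s) i j   ∎

  *P-identityˡ : ∀ p → 1P *P p ≈ p
  *P-identityˡ p i j = begin
    coeff (1P *P p) i j                                ≡⟨ coeff-*P 1P p i j ⟩
    ∑ₗ p (λ u → termCoeff ((0 , 0 , 1ℤ) ·ₜ u) i j) ℤ.+ 0ℤ ≡⟨ ℤP.+-identityʳ _ ⟩
    ∑ₗ p (λ u → termCoeff ((0 , 0 , 1ℤ) ·ₜ u) i j)     ≡⟨ ∑ₗ-cong p (λ { (i′ , j′ , c) → cong (λ z → termCoeff (i′ , j′ , z) i j) (ℤP.*-identityˡ c) }) ⟩
    ∑ₗ p (λ u → termCoeff u i j)                       ≡⟨ coeff≡∑ₗ p i j ⟨
    coeff p i j                                        ∎

  *P-identityʳ : ∀ p → p *P 1P ≈ p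
  *P-identityʳ p i j = trans (*P-comm p 1P i j) (*P-identityˡ p i j)

  +P-cong : ∀ {p p′ r r′} → p ≈ p′ → r ≈ r′ → p +P r ≈ p′ +P r′
  +P-cong {p} {p′} {r} {r′} p≈p′ r≈r′ i j =
    trans (coeff-+P p r i j) (trans (cong₂ ℤ._+_ (p≈p′ i j) (r≈r′ i j)) (sym (coeff-+P p′ r′ i j)))

  +P-assoc : ∀ p r s → (p +P r) +P s ≈ p +P (r +P s)
  +P-assoc p r s i j rewrite Data.List.Properties.++-assoc p r s = refl

  +P-comm : ∀ p r → p +P r ≈ r +P p
  +P-comm p r i j = trans (coeff-+P p r i j) (trans (ℤP.+-comm (coeff p i j) _) (sym (coeff-+P r p i j)))

  +P-identityˡ : ∀ p → 0P +P p ≈ p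
  +P-identityˡ p i j = refl

  +P-identityʳ : ∀ p → p +P 0P ≈ p
  +P-identityʳ p i j rewrite Data.List.Properties.++-identityʳ p = refl

  -P-cong : ∀ {p p′} → p ≈ p′ → -P p ≈ -P p′
  -P-cong {p} {p′} p≈p′ i j = trans (coeff--P p i j) (trans (cong ℤ.-_ (p≈p′ i j)) (sym (coeff--P p′ i j)))

  -P-inverseˡ : ∀ p → (-P p) +P p ≈ 0P
  -P-inverseˡ p i j =
    trans (coeff-+P (-P p) p i j) (trans (cong (ℤ._+ coeff p i j) (coeff--P p i j)) (ℤP.+-inverseˡ (coeff p i j)))

  -P-inverseʳ : ∀ p → p +P (-P p) ≈ 0P
  -P-inverseʳ p i j = trans (+P-comm p (-P p) i j) (-P-inverseˡ p i j)

  -- A function type such as p ≈ r does not determine p and r, so Agda could not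
  -- infer them from an equation; the record wrapper restores that inference.
  infix 4 _≋_
  record _≋_ (p r : Poly) : Set where
    constructor ⟪_⟫
    field coeffwise : p ≈ r
  open _≋_ public

  ≋-isEquivalence : IsEquivalence _≋_
  ≋-isEquivalence = record
    { refl  = ⟪ (λ i j → refl) ⟫
    ; sym   = λ p≋r → ⟪ (λ i j → sym (coeffwise p≋r i j)) ⟫
    ; trans = λ p≋r r≋s → ⟪ (λ i j → trans (coeffwise p≋r i j) (coeffwise r≋s i j)) ⟫
    }

  polyCommutativeRing : CommutativeRing 0ℓ 0ℓ
  polyCommutativeRing = record
    { Carrier = Poly ; _≈_ = _≋_ ; _+_ = _+P_ ; _*_ = _*P_ ; -_ = -P_ ; 0# = 0P ; 1# = 1P
    ; isCommutativeRing = record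
      { isRing = record
        { +-isAbelianGroup = record
          { isGroup = record
            { isMonoid = record
              { isSemigroup = record
                { isMagma = record
                  { isEquivalence = ≋-isEquivalence
                  ; ∙-cong = λ {p} {p′} {r} {r′} p≋p′ r≋r′ → ⟪ +P-cong {p} {p′} {r} {r′} (coeffwise p≋p′) (coeffwise r≋r′) ⟫
                  }
                ; assoc = λ p r s → ⟪ +P-assoc p r s ⟫
                }
              ; identity = (λ p → ⟪ +P-identityˡ p ⟫) , (λ p → ⟪ +P-identityʳ p ⟫)
              }
            ; inverse = (λ p → ⟪ -P-inverseˡ p ⟫) , (λ p → ⟪ -P-inverseʳ p ⟫)
            ; ⁻¹-cong = λ {p} {p′} p≋p′ → ⟪ -P-cong {p} {p′} (coeffwise p≋p′) ⟫
            }
          ; comm = λ p r → ⟪ +P-comm p r ⟫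
          }
        ; *-cong     = λ {p} {p′} {r} {r′} p≋p′ r≋r′ → ⟪ *P-cong {p} {p′} {r} {r′} (coeffwise p≋p′) (coeffwise r≋r′) ⟫
        ; *-assoc    = λ p r s → ⟪ *P-assoc p r s ⟫
        ; *-identity = (λ p → ⟪ *P-identityˡ p ⟫) , (λ p → ⟪ *P-identityʳ p ⟫)
        ; distrib    = (λ p r s → ⟪ *P-distribˡ p r s ⟫) , (λ p r s → ⟪ *P-distribʳ p r s ⟫)
        }
      ; *-comm = λ p r → ⟪ *P-comm p r ⟫
      }
    }

module PolynomialSolver where

  open PolynomialRing
  import Algebra.Solver.Ring.AlmostCommutativeRing as ACR
  open ≡ using (refl)

  if-+ : ∀ (b : Bool) (x y : ℤ) → (if b then x ℤ.+ y else 0ℤ) ℤ.+ 0ℤ ≡ (if b then x else 0ℤ) ℤ.+ ((if b then y else 0ℤ) ℤ.+ 0ℤ)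
  if-+ true  x y = ≡.trans (ℤP.+-identityʳ _) (≡.cong (ℤ._+_ x) (≡.sym (ℤP.+-identityʳ y)))
  if-+ false x y = refl

  if-0 : ∀ (b : Bool) → (if b then 0ℤ else 0ℤ) ℤ.+ 0ℤ ≡ 0ℤ
  if-0 true  = refl
  if-0 false = refl

  constant : ACR._-Raw-AlmostCommutative⟶_ ℤ.+-*-rawRing (ACR.fromCommutativeRing polyCommutativeRing)
  constant = record
    { ⟦_⟧    = mono 0 0
    ; +-homo = λ x y → ⟪ (λ i j → if-+ (⌊ 0 ℕ.≟ i ⌋ ∧ ⌊ 0 ℕ.≟ j ⌋) x y) ⟫
    ; *-homo = λ x y → ⟪ (λ i j → refl) ⟫
    ; -‿homo = λ x → ⟪ (λ i j → refl) ⟫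
    ; 0-homo = ⟪ (λ i j → if-0 (⌊ 0 ℕ.≟ i ⌋ ∧ ⌊ 0 ℕ.≟ j ⌋)) ⟫
    ; 1-homo = ⟪ (λ i j → refl) ⟫
    }

  constant-≟ : ∀ (x y : ℤ) → Maybe (mono 0 0 x ≋ mono 0 0 y)
  constant-≟ x y with x ℤP.≟ y
  ... | yes refl = just ⟪ (λ i j → refl) ⟫
  ... | no _     = nothing

  open import Algebra.Solver.Ring ℤ.+-*-rawRing (ACR.fromCommutativeRing polyCommutativeRing) constant constant-≟ public
    using (solve; _:=_; _:+_; _:*_; con)

module QStirling where

  open PolynomialRing
  open PolynomialSolver
  open CommutativeRing polyCommutativeRing
    using (refl; sym; trans; setoid; +-cong; +-congˡ; +-congʳ; *-congˡ; *-congʳ; +-identityʳ; *-identityˡ; zeroˡ; zeroʳ; distribʳ)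
  open FiniteSums polyCommutativeRing
  open import Relation.Binary.Reasoning.Setoid setoid

  A Q : Poly
  A = a^ 1
  Q = q^ 1

  -- [k]_q through [k + 1]_q = 1 + q [k]_q, the form in which the algebra below uses it.
  qint′ : ℕ → Poly
  qint′ zero    = 0P
  qint′ (suc k) = 1P +P Q *P qint′ k

  qint≋qint′ : ∀ k → qint k ≋ qint′ k
  qint≋qint′ zero    = refl
  qint≋qint′ (suc k) = trans (+-congʳ (qint≋qint′ k)) (qint′-snoc k)
    where
    qint′-snoc : ∀ k → qint′ k +P q^ k ≋ 1P +P Q *P qint′ k
    qint′-snoc zero    = refl
    qint′-snoc (suc k) = begin
      (1P +P Q *P qint′ k) +P Q *P q^ k
        ≈⟨ solve 4 (λ o q x u → (o :+ q :* x) :+ q :* u := o :+ q :* (x :+ u)) refl 1P Q (qint′ k) (q^ k) ⟩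
      1P +P Q *P (qint′ k +P q^ k)        ≈⟨ +-congˡ {1P} (*-congˡ {Q} (qint′-snoc k)) ⟩
      1P +P Q *P (1P +P Q *P qint′ k)     ∎

  b l : ℕ → Poly
  b k = qint′ k +P A *P q^ k
  l k = A *P q^ k *P qint′ (suc k)

  open JacobiFraction polyCommutativeRing b l public

  -- The L-matrix of the J-fraction with b k = a q^k and no down steps; its moments are the a^j.
  Lₐ : ℕ → ℕ → Poly
  Lₐ zero    k = δ 0 k
  Lₐ (suc j) k = shift (Lₐ j) k +P A *P q^ k *P Lₐ j k

  Lₐ-moment : ∀ j → Lₐ j 0 ≋ a^ j
  Lₐ-moment zero    = refl
  Lₐ-moment (suc j) = *-congˡ {A *P q^ 0} (Lₐ-moment j)

  Lₐ-qint : ∀ j k → qint′ j *P Lₐ j k ≋ qint′ k *P Lₐ j k +P l k *P Lₐ j (suc k)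
  Lₐ-qint zero    zero    = sym (zeroʳ (l 0))
  Lₐ-qint zero    (suc k) = sym (trans (+-cong (zeroʳ (qint′ (suc k))) (zeroʳ (l (suc k)))) (+-identityʳ 0P))
  Lₐ-qint (suc j) zero    = begin
    qint′ (suc j) *P Lₐ (suc j) 0
      ≈⟨ solve 4 (λ q J a y → (con 1ℤ :+ q :* J) :* (a :* con 1ℤ :* y) := a :* con 1ℤ :* y :+ (q :* a) :* (J :* y))
               refl Q (qint′ j) A (Lₐ j 0) ⟩
    A *P 1P *P Lₐ j 0 +P (Q *P A) *P (qint′ j *P Lₐ j 0)
      ≈⟨ +-congˡ {A *P 1P *P Lₐ j 0} (*-congˡ {Q *P A} (Lₐ-qint j 0)) ⟩
    A *P 1P *P Lₐ j 0 +P (Q *P A) *P (qint′ 0 *P Lₐ j 0 +P l 0 *P Lₐ j 1)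
      ≈⟨ solve 5 (λ q J a y z → a :* con 1ℤ :* y :+ (q :* a) :* ((a :* con 1ℤ :* con 1ℤ) :* z)
                                := (a :* con 1ℤ :* con 1ℤ) :* (y :+ a :* q :* z))
               refl Q (qint′ j) A (Lₐ j 0) (Lₐ j 1) ⟩
    qint′ 0 *P Lₐ (suc j) 0 +P l 0 *P Lₐ (suc j) 1 ∎
  Lₐ-qint (suc j) (suc k) = begin
    qint′ (suc j) *P Lₐ (suc j) (suc k)
      ≈⟨ solve 6 (λ q J a u x y → (con 1ℤ :+ q :* J) :* (x :+ a :* (q :* u) :* y)
                                  := (x :+ a :* (q :* u) :* y) :+ q :* (J :* x) :+ (q :* (a :* (q :* u))) :* (J :* y))
               refl Q (qint′ j) A (q^ k) x y ⟩
    (x +P A *P (Q *P q^ k) *P y) +P Q *P (qint′ j *P x) +P (Q *P (A *P (Q *P q^ k))) *P (qint′ j *P y)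
      ≈⟨ +-cong (+-congˡ {x +P A *P (Q *P q^ k) *P y} (*-congˡ {Q} (Lₐ-qint j k)))
                (*-congˡ {Q *P (A *P (Q *P q^ k))} (Lₐ-qint j (suc k))) ⟩
    (x +P A *P (Q *P q^ k) *P y) +P Q *P (qint′ k *P x +P l k *P y)
      +P (Q *P (A *P (Q *P q^ k))) *P (qint′ (suc k) *P y +P l (suc k) *P z)
      ≈⟨ solve 8 (λ q J a u x y z K →
           (x :+ a :* (q :* u) :* y) :+ q :* (K :* x :+ (a :* u :* (con 1ℤ :+ q :* K)) :* y)
             :+ (q :* (a :* (q :* u))) :* ((con 1ℤ :+ q :* K) :* y :+ (a :* (q :* u) :* (con 1ℤ :+ q :* (con 1ℤ :+ q :* K))) :* z)
           := (con 1ℤ :+ q :* K) :* (x :+ a :* (q :* u) :* y)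
                :+ (a :* (q :* u) :* (con 1ℤ :+ q :* (con 1ℤ :+ q :* K))) :* (y :+ a :* (q :* (q :* u)) :* z))
           refl Q (qint′ j) A (q^ k) x y z (qint′ k) ⟩
    qint′ (suc k) *P Lₐ (suc j) (suc k) +P l (suc k) *P Lₐ (suc j) (suc (suc k)) ∎
    where
    x = Lₐ j k
    y = Lₐ j (suc k)
    z = Lₐ j (suc (suc k))

  Sq-rec : ∀ m j → Sq (suc m) j ≋ shift (Sq m) j +P qint′ j *P Sq m j
  Sq-rec m zero    = refl
  Sq-rec m (suc j) = +-congˡ {Sq m j} (*-congʳ (qint≋qint′ (suc j)))

  Sq-upper : ∀ {m j} → m < j → Sq m j ≋ 0P
  Sq-upper {zero}  {suc j} _         = refl
  Sq-upper {suc m} {suc j} (s≤s m<j) =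
    +-cong (Sq-upper m<j) (trans (*-congˡ {qint (suc j)} (Sq-upper (m<n⇒m<1+n m<j))) (zeroʳ (qint (suc j))))

  -- Lₐ-qint turns one step of the paths behind L into the recurrence of S_q.
  Sq-step : ∀ m j k →
    Sq m j *P shift (Lₐ j) k +P b k *P (Sq m j *P Lₐ j k) +P l k *P (Sq m j *P Lₐ j (suc k))
      ≋ Sq m j *P Lₐ (suc j) k +P qint′ j *P Sq m j *P Lₐ j k
  Sq-step m j k = begin
    S *P shift (Lₐ j) k +P b k *P (S *P Lₐ j k) +P l k *P (S *P Lₐ j (suc k))
      ≈⟨ solve 8 (λ s p K a u x y w → s :* p :+ (K :+ a :* u) :* (s :* x) :+ w :* (s :* y)
                                      := s :* (p :+ a :* u :* x) :+ s :* (K :* x :+ w :* y))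
               refl S (shift (Lₐ j) k) (qint′ k) A (q^ k) (Lₐ j k) (Lₐ j (suc k)) (l k) ⟩
    S *P Lₐ (suc j) k +P S *P (qint′ k *P Lₐ j k +P l k *P Lₐ j (suc k))
      ≈⟨ +-congˡ {S *P Lₐ (suc j) k} (*-congˡ {S} (Lₐ-qint j k)) ⟨
    S *P Lₐ (suc j) k +P S *P (qint′ j *P Lₐ j k)
      ≈⟨ solve 4 (λ s c J x → s :* c :+ s :* (J :* x) := s :* c :+ J :* s :* x) refl S (Lₐ (suc j) k) (qint′ j) (Lₐ j k) ⟩
    S *P Lₐ (suc j) k +P qint′ j *P S *P Lₐ j k ∎
    where S = Sq m j

  L≈Sq·Lₐ : ∀ {N} m → m < N → ∀ k → L m k ≋ ∑< N (λ j → Sq m j *P Lₐ j k)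
  L≈Sq·Lₐ {suc N} zero    _         k =
    sym (trans (+-cong (*-identityˡ (δ 0 k)) (∑<-zero N (λ j _ → zeroˡ (Lₐ (suc j) k)))) (+-identityʳ (δ 0 k)))
  L≈Sq·Lₐ {suc M} (suc m) (s≤s m<M) k = begin
    shift (L m) k +P b k *P L m k +P l k *P L m (suc k)
      ≈⟨ +-cong (+-cong (shift-IH k) (*-congˡ {b k} (IH k))) (*-congˡ {l k} (IH (suc k))) ⟩
    ∑< N up +P b k *P ∑< N (λ j → S j *P Lₐ j k) +P l k *P ∑< N (λ j → S j *P Lₐ j (suc k))
      ≈⟨ +-cong (+-congˡ {∑< N up} (*-distribˡ-∑< N (b k) (λ j → S j *P Lₐ j k)))
                (*-distribˡ-∑< N (l k) (λ j → S j *P Lₐ j (suc k))) ⟩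
    ∑< N up +P ∑< N level +P ∑< N down
      ≈⟨ trans (∑<-distrib-+ N (λ j → up j +P level j) down) (+-congʳ (∑<-distrib-+ N up level)) ⟨
    ∑< N (λ j → up j +P level j +P down j)
      ≈⟨ ∑<-cong N (λ j _ → Sq-step m j k) ⟩
    ∑< N (λ j → S j *P Lₐ (suc j) k +P qint′ j *P S j *P Lₐ j k)
      ≈⟨ ∑<-distrib-+ N (λ j → S j *P Lₐ (suc j) k) (λ j → qint′ j *P S j *P Lₐ j k) ⟩
    ∑< N (λ j → S j *P Lₐ (suc j) k) +P ∑< N (λ j → qint′ j *P S j *P Lₐ j k)
      ≈⟨ +-congʳ (∑<-truncate (λ j → S j *P Lₐ (suc j) k) (n≤1+n M)
                   (λ j M≤j → trans (*-congʳ (Sq-upper (<-≤-trans m<M M≤j))) (zeroˡ (Lₐ (suc j) k)))) ⟩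
    ∑< N (λ j → shift S j *P Lₐ j k) +P ∑< N (λ j → qint′ j *P S j *P Lₐ j k)
      ≈⟨ ∑<-distrib-+ N (λ j → shift S j *P Lₐ j k) (λ j → qint′ j *P S j *P Lₐ j k) ⟨
    ∑< N (λ j → shift S j *P Lₐ j k +P qint′ j *P S j *P Lₐ j k)
      ≈⟨ ∑<-cong N (λ j _ → trans (*-congʳ {Lₐ j k} (Sq-rec m j)) (distribʳ (Lₐ j k) (shift S j) (qint′ j *P S j))) ⟨
    ∑< N (λ j → Sq (suc m) j *P Lₐ j k) ∎
    where
    N = suc M
    S = Sq m
    IH : ∀ k → L m k ≋ ∑< N (λ j → S j *P Lₐ j k)
    IH = L≈Sq·Lₐ m (m<n⇒m<1+n m<M)
    up level down : ℕ → Poly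
    up    j = S j *P shift (Lₐ j) k
    level j = b k *P (S j *P Lₐ j k)
    down  j = l k *P (S j *P Lₐ j (suc k))
    shift-IH : ∀ k → shift (L m) k ≋ ∑< N (λ j → S j *P shift (Lₐ j) k)
    shift-IH zero    = sym (∑<-zero N (λ j _ → zeroʳ (S j)))
    shift-IH (suc k) = IH k

  sumUpTo≋∑< : ∀ n f → sumUpTo n f ≋ ∑< (suc n) f
  sumUpTo≋∑< zero    f = sym (+-identityʳ (f 0))
  sumUpTo≋∑< (suc n) f = trans (+-congʳ (sumUpTo≋∑< n f)) (sym (∑<-snoc (suc n) f))

  B≋moment : ∀ m → B m ≋ L m 0
  B≋moment m = begin
    B m                                  ≈⟨ sumUpTo≋∑< m (λ j → Sq m j *P a^ j) ⟩
    ∑< (suc m) (λ j → Sq m j *P a^ j)    ≈⟨ ∑<-cong (suc m) (λ j _ → *-congˡ {Sq m j} (Lₐ-moment j)) ⟨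
    ∑< (suc m) (λ j → Sq m j *P Lₐ j 0)  ≈⟨ L≈Sq·Lₐ m (n<1+n m) 0 ⟨
    L m 0                                ∎

  μ≋ : ∀ k → μ k ≋ a^ k *P q^ (k C 2) *P qfact k
  μ≋ zero    = refl
  μ≋ (suc k) = begin
    l k *P μ k
      ≈⟨ *-congˡ {l k} (μ≋ k) ⟩
    A *P q^ k *P qint′ (suc k) *P (a^ k *P q^ (k C 2) *P qfact k)
      ≈⟨ solve 6 (λ a u Q x v f → a :* u :* Q :* (x :* v :* f) := (a :* x) :* (u :* v) :* (f :* Q))
               refl A (q^ k) (qint′ (suc k)) (a^ k) (q^ (k C 2)) (qfact k) ⟩
    a^ (suc k) *P q^ (k ℕ.+ k C 2) *P (qfact k *P qint′ (suc k))
      ≈⟨ *-congˡ {a^ (suc k) *P q^ (k ℕ.+ k C 2)} (*-congˡ {qfact k} (qint≋qint′ (suc k))) ⟨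
    a^ (suc k) *P q^ (k ℕ.+ k C 2) *P qfact (suc k)
      ≡⟨ ≡.cong (λ e → a^ (suc k) *P q^ e *P qfact (suc k)) (suc-C2 k) ⟨
    a^ (suc k) *P q^ (suc k C 2) *P qfact (suc k) ∎
    where
    suc-C2 : ∀ k → suc k C 2 ≡ k ℕ.+ k C 2
    suc-C2 k = ≡.trans (≡.sym (nCk+nC[k+1]≡[n+1]C[k+1] k 1)) (≡.cong (ℕ._+ k C 2) (nC1≡n k))

module Determinant where

  open PolynomialRing
  open CommutativeRing polyCommutativeRing using (refl; trans; +-cong; +-congˡ; *-cong; *-congˡ; *-congʳ; -‿cong; +-identityʳ; zeroˡ; zeroʳ)

  minor : ∀ {n} → Mat (suc n) (suc n) → Fin (suc n) → Mat n n
  minor M j r c = M (fsuc r) (punchIn j c)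

  sign-zero : ∀ k {x} → x ≋ 0P → sign k x ≋ 0P
  sign-zero zero    x≋0 = x≋0
  sign-zero (suc k) x≋0 = -‿cong (sign-zero k x≋0)

  sumFin-zero : ∀ N {f : Fin N → Poly} → (∀ k → f k ≋ 0P) → sumFin N f ≋ 0P
  sumFin-zero zero    _   = refl
  sumFin-zero (suc N) f≋0 = +-cong (f≋0 fzero) (sumFin-zero N (f≋0 ∘ fsuc))

  det-leading : ∀ n (M : Mat (suc n) (suc n)) → (∀ j → M fzero (fsuc j) *P det n (minor M (fsuc j)) ≋ 0P) →
                det (suc n) M ≋ M fzero fzero *P det n (minor M fzero)
  det-leading n M rest≋0 = trans (+-congˡ (sumFin-zero n (λ j → sign-zero (suc (toℕ j)) (rest≋0 j)))) (+-identityʳ _)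

  mutual
    det-firstColumnZero : ∀ n (M : Mat (suc n) (suc n)) → (∀ r → M r fzero ≋ 0P) → det (suc n) M ≋ 0P
    det-firstColumnZero n M col≋0 = trans
      (det-leading n M (λ j → trans (*-congˡ {M fzero (fsuc j)} (minor-firstColumnZero M j (col≋0 ∘ fsuc)))
                                    (zeroʳ (M fzero (fsuc j)))))
      (trans (*-congʳ {det n (minor M fzero)} (col≋0 fzero)) (zeroˡ (det n (minor M fzero))))

    -- Deleting a column other than the first keeps the first column.
    minor-firstColumnZero : ∀ {n} (M : Mat (suc n) (suc n)) (j : Fin n) →
                            (∀ r → M (fsuc r) fzero ≋ 0P) → det n (minor M (fsuc j)) ≋ 0P
    minor-firstColumnZero {suc n} M j col≋0 = det-firstColumnZero n (minor M (fsuc j)) col≋0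

  det-lowerUnitriangular : ∀ n (M : Mat n n) → (∀ i j → toℕ i < toℕ j → M i j ≋ 0P) → (∀ i → M i i ≋ 1P) → det n M ≋ 1P
  det-lowerUnitriangular zero    M _       _      = refl
  det-lowerUnitriangular (suc n) M upper≋0 diag≋1 = trans
    (det-leading n M (λ j → trans (*-congʳ {det n (minor M (fsuc j))} (upper≋0 fzero (fsuc j) z<s)) (zeroˡ (det n (minor M (fsuc j))))))
    (*-cong (diag≋1 fzero) (det-lowerUnitriangular n (minor M fzero) (λ i j → upper≋0 (fsuc i) (fsuc j) ∘ s<s) (diag≋1 ∘ fsuc)))

  det-upperUnitriangular : ∀ n (M : Mat n n) → (∀ i j → toℕ j < toℕ i → M i j ≋ 0P) → (∀ i → M i i ≋ 1P) → det n M ≋ 1P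
  det-upperUnitriangular zero    M _       _      = refl
  det-upperUnitriangular (suc n) M lower≋0 diag≋1 = trans
    (det-leading n M (λ j → trans (*-congˡ {M fzero (fsuc j)} (minor-firstColumnZero M j (λ r → lower≋0 (fsuc r) fzero z<s)))
                                  (zeroʳ (M fzero (fsuc j)))))
    (*-cong (diag≋1 fzero) (det-upperUnitriangular n (minor M fzero) (λ i j → lower≋0 (fsuc i) (fsuc j) ∘ s<s) (diag≋1 ∘ fsuc)))

open PolynomialRing using (_≋_; coeffwise; polyCommutativeRing)
open CommutativeRing polyCommutativeRing using (refl; sym; trans; reflexive; setoid; *-congˡ; *-congʳ; *-identityʳ; zeroʳ)
open FiniteSums polyCommutativeRing using (∑<; ∑<-cong; δ; δ-refl; δ-≢)
open QStirling using (P; P-upper; P-diag; μ; μ≋; μ-divides; L; B≋moment; hankel-diagonalisation)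
open Determinant using (det-lowerUnitriangular; det-upperUnitriangular)
open import Relation.Binary.Reasoning.Setoid setoid

Pmat Pmatᵀ : (n : ℕ) → Mat (suc n) (suc n)
Pmat  n i j = P (toℕ i) (toℕ j)
Pmatᵀ n i j = P (toℕ j) (toℕ i)

sumFin≡∑< : ∀ N (f : ℕ → Poly) → sumFin N (f ∘ toℕ) ≡ ∑< N f
sumFin≡∑< zero    f = ≡.refl
sumFin≡∑< (suc N) f = ≡.cong (f 0 +P_) (sumFin≡∑< N (f ∘ suc))

Pmat-Bmat-Pmatᵀ : ∀ n i k → ((Pmat n ⊗ Bmat n) ⊗ Pmatᵀ n) i k ≋ μ (toℕ i) *P δ (toℕ k) (toℕ i)
Pmat-Bmat-Pmatᵀ n i k = begin
  sumFin N (λ j′ → sumFin N (λ j → P i′ (toℕ j) *P B (toℕ j ℕ.+ toℕ j′)) *P P k′ (toℕ j′))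
    ≡⟨ sumFin≡∑< N (λ j′ → sumFin N (λ j → P i′ (toℕ j) *P B (toℕ j ℕ.+ j′)) *P P k′ j′) ⟩
  ∑< N (λ j′ → sumFin N (λ j → P i′ (toℕ j) *P B (toℕ j ℕ.+ j′)) *P P k′ j′)
    ≈⟨ ∑<-cong N (λ j′ _ → *-congʳ {P k′ j′} (reflexive (sumFin≡∑< N (λ j → P i′ j *P B (j ℕ.+ j′))))) ⟩
  ∑< N (λ j′ → ∑< N (λ j → P i′ j *P B (j ℕ.+ j′)) *P P k′ j′)
    ≈⟨ ∑<-cong N (λ j′ _ → *-congʳ {P k′ j′} (∑<-cong N (λ j _ → *-congˡ {P i′ j} (B≋moment (j ℕ.+ j′))))) ⟩
  ∑< N (λ j′ → ∑< N (λ j → P i′ j *P L (j ℕ.+ j′) 0) *P P k′ j′)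
    ≈⟨ hankel-diagonalisation N i′ k′ (toℕ<n i) (toℕ<n k) ⟩
  μ i′ *P δ k′ i′ ∎
  where
  N  = suc n
  i′ = toℕ i
  k′ = toℕ k

Dmat≋μδ : ∀ n (i k : Fin (suc n)) → Dmat n i k ≋ μ (toℕ i) *P δ (toℕ k) (toℕ i)
Dmat≋μδ n i k with toℕ i ℕ.≟ toℕ k
... | yes i≡k = begin
  a^ (toℕ i) *P q^ (toℕ i C 2) *P qfact (toℕ i) ≈⟨ μ≋ (toℕ i) ⟨
  μ (toℕ i)                                    ≈⟨ *-identityʳ (μ (toℕ i)) ⟨
  μ (toℕ i) *P 1P                              ≡⟨ ≡.cong (μ (toℕ i) *P_) (≡.trans (≡.cong (λ m → δ m (toℕ i)) (≡.sym i≡k)) (δ-refl (toℕ i))) ⟨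
  μ (toℕ i) *P δ (toℕ k) (toℕ i)               ∎
... | no i≢k = begin
  0P                                           ≈⟨ zeroʳ (μ (toℕ i)) ⟨
  μ (toℕ i) *P 0P                              ≡⟨ ≡.cong (μ (toℕ i) *P_) (δ-≢ (i≢k ∘ ≡.sym)) ⟨
  μ (toℕ i) *P δ (toℕ k) (toℕ i)               ∎

Dmat-diagonal : ∀ n → IsDiagonal (Dmat n)
Dmat-diagonal n i j i≢j = coeffwise (begin
  Dmat n i j                       ≈⟨ Dmat≋μδ n i j ⟩
  μ (toℕ i) *P δ (toℕ j) (toℕ i)   ≡⟨ ≡.cong (μ (toℕ i) *P_) (δ-≢ (i≢j ∘ ≡.sym)) ⟩
  μ (toℕ i) *P 0P                  ≈⟨ zeroʳ (μ (toℕ i)) ⟩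
  0P                               ∎)

Dmat-diag : ∀ n (i i′ : Fin (suc n)) → toℕ i ≡ toℕ i′ → Dmat n i i′ ≋ μ (toℕ i)
Dmat-diag n i i′ i≡i′ = begin
  Dmat n i i′                      ≈⟨ Dmat≋μδ n i i′ ⟩
  μ (toℕ i) *P δ (toℕ i′) (toℕ i)  ≡⟨ ≡.cong (μ (toℕ i) *P_) (≡.trans (≡.cong (λ m → δ m (toℕ i)) (≡.sym i≡i′)) (δ-refl (toℕ i))) ⟩
  μ (toℕ i) *P 1P                  ≈⟨ *-identityʳ (μ (toℕ i)) ⟩
  μ (toℕ i)                        ∎

Dmat-divides : ∀ n → DiagDivides (Dmat n)
Dmat-divides n i j i′ j′ i≡i′ j≡j′ j≤i with μ-divides j≤i
... | c , μi≈cμj = c , coeffwise (trans (Dmat-diag n i i′ i≡i′) (trans μi≈cμj (*-congˡ {c} (sym (Dmat-diag n j j′ j≡j′)))))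

corollary4p3 : (n : ℕ) → IsSSNF (Bmat n) (Dmat n)
corollary4p3 n =
    Pmat n , Pmatᵀ n
  , coeffwise (det-lowerUnitriangular (suc n) (Pmat n) (λ i j → P-upper) (λ i → P-diag (toℕ i)))
  , coeffwise (det-upperUnitriangular (suc n) (Pmatᵀ n) (λ i j → P-upper) (λ i → P-diag (toℕ i)))
  , (λ i k → coeffwise (trans (Pmat-Bmat-Pmatᵀ n i k) (sym (Dmat≋μδ n i k))))
  , Dmat-diagonal n
  , Dmat-divides n
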